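{- For every $n\ge 1$, any two consecutive elements of the list $\mathcal{L}_n$ (defined in the context) differ in exactly one position, i.e. they have Hamming distance one.
   Context: Consider the succession rule for the Catalan numbers with axiom $(2)$ and productions $(k)\rightsquigarrow(2)(3)\cdots(k)(k+1)$ for $k\ge 2$. A word of length $n$ is a sequence $w_1w_2\cdots w_n$ of integers with $w_1=2$ and $w_{m+1}\in\{2,3,\dots,w_m+1\}$ for $1\le m<n$ (these are the root-to-node paths in the generating tree). For a list $L$ of words, $\mathrm{first}(L)$ and $\mathrm{last}(L)$ denote its first and last element; for a word $x$, $\overrightarrow{x}$ denotes its rightmost digit; $x\circ L$ denotes the list obtained by appending each element of the list $L$ (in order) to the word $x$; $\Theta$ denotes concatenation of lists. For $k\ge 2$ define the shifted productions (lists): $s(k,2)=\langle 2,k+1,k,k-1,\dots,4,3\rangle$ (i.e. $2$ followed by the integers from $k+1$ down to $3$; so $s(2,2)=\langle 2,3\rangle$), and for $3\le i\le k+1$, $s(k,i)=\langle i,i+1,\dots,k,k+1,2,3,\dots,i-1\rangle$. Define lists $\mathcal{L}_n$ recursively: $\mathcal{L}_1=\langle 2\rangle$, and for $n>1$, writing $l^{n-1}_i$ for the $i$-th element of $\mathcal{L}_{n-1}$ and $M=|\mathcal{L}_{n-1}|$, set $\mathcal{L}_n=\Theta_{i=1}^{M} L^i_n$, where $L^1_n=l^{n-1}_1\circ s(2,2)$ and, for $i>1$, $L^i_n=l^{n-1}_i\circ s\big(\overrightarrow{l^{n-1}_i},\overrightarrow{\mathrm{last}(L^{i-1}_n)}\big)$.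 -}

module Defs where

open import Data.Nat using (ℕ; zero; suc; _+_; _∸_; _≤?_)
open import Data.List using (List; []; _∷_; _++_; map; reverse; last; concat)
open import Data.Maybe using (Maybe; just; nothing)
open import Data.Bool using (if_then_else_)
open import Relation.Nullary.Decidable using (⌊_⌋)
open import Data.Nat using (_≡ᵇ_)

Word : Set
Word = List ℕ

range : ℕ → ℕ → List ℕ
range a zero    = []
range a (suc l) = a ∷ range (suc a) l

-- the integers from a up to b inclusive (empty if b < a)
fromTo : ℕ → ℕ → List ℕ
fromTo a b = range a (suc b ∸ a)

-- shifted productions s(k,i)
--   s(k,2) = ⟨2, k+1, k, …, 3⟩
--   s(k,i) = ⟨i, i+1, …, k+1, 2, 3, …, i-1⟩   for 3 ≤ i ≤ k+1
-- (only used for 2 ≤ i ≤ k+1; other arguments never occur)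
s : ℕ → ℕ → List ℕ
s k 2 = 2 ∷ reverse (fromTo 3 (suc k))
s k i = fromTo i (suc k) ++ fromTo 2 (i ∸ 1)

_∘ʷ_ : Word → List ℕ → List Word
x ∘ʷ L = map (λ d → x ++ (d ∷ [])) L

-- rightmost digit of a word (0 for the empty word, never used)
rightmost : Word → ℕ
rightmost w with last w
... | just d  = d
... | nothing = 0

-- rightmost digit of the last element of a list of words (default 2)
lastDigit : List Word → ℕ
lastDigit L with last L
... | just w  = rightmost w
... | nothing = 2

-- Build the blocks L^i_n for i > 1, given the rightmost digit of
-- last(L^{i-1}_n) as accumulator.
blocks : ℕ → List Word → List Word
blocks prev []       = []
blocks prev (l ∷ ls) =
  let B = l ∘ʷ s (rightmost l) prev
  in B ++ blocks (lastDigit B) ls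

step : List Word → List Word
step []       = []
step (l ∷ ls) = let B = l ∘ʷ s 2 2 in B ++ blocks (lastDigit B) ls

-- 𝓛 n, for n ≥ 1 (𝓛 0 and 𝓛 1 are both ⟨2⟩; 𝓛 0 is a dummy value)
𝓛 : ℕ → List Word
𝓛 zero          = (2 ∷ []) ∷ []
𝓛 (suc zero)    = (2 ∷ []) ∷ []
𝓛 (suc (suc n)) = step (𝓛 (suc n))

-- Hamming distance: number of positions where two words differ
-- (the words compared always have equal length; any excess length also counts).
hamming : Word → Word → ℕ
hamming []       []       = 0
hamming []       (y ∷ ys) = suc (hamming [] ys)
hamming (x ∷ xs) []       = suc (hamming xs [])
hamming (x ∷ xs) (y ∷ ys) = (if x ≡ᵇ y then 0 else 1) + hamming xs ys

-- Inside a block x ∘ s(k,i) consecutive words differ only in their last digit, since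
-- consecutive digits of s(k,i) are distinct. At the seam between the blocks of two
-- consecutive words l, l′ of 𝓛ₙ₋₁, the last word of the first block and the first word
-- of the second end in the same digit i, because s(k,i) starts with i; so they differ
-- exactly where l and l′ do. The seam digit alternates between 2 and 3 (s(k,2) ends in 3,
-- s(k,3) ends in 2), which keeps i in the range 2 ≤ i ≤ k+1 where s(k,i) behaves,
-- as every label k is at least 2.
module Submission where

open import Defs
open import Data.Nat using (ℕ; _≥_)
open import Relation.Binary.PropositionalEquality using (_≡_)
open import Data.List.Relation.Unary.Linked using (Linked)

open import Data.Bool using (true; false; if_then_else_)
open import Data.List using (List; []; _∷_; _++_; _∷ʳ_; length; head; last; reverse; applyUpTo; applyDownFrom)
open import Data.List.Properties using (length-++; last-map; reverse-applyUpTo)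
open import Data.List.Relation.Unary.All as All using (All; []; _∷_)
import Data.List.Relation.Unary.All.Properties as Allₚ
open import Data.List.Relation.Unary.Linked as Linked using ([]; [-]; _∷_; head′; tail)
import Data.List.Relation.Unary.Linked.Properties as Linkedₚ
open import Data.Maybe as Maybe using (just)
open import Data.Maybe.Relation.Binary.Connected using (Connected; just)
open import Data.Nat using (zero; suc; _+_; _∸_; _≤_; _≡ᵇ_; z≤n; s≤s)
open import Data.Nat.Properties
  using (+-comm; +-identityʳ; +-suc; ≤-refl; ≤-trans; n≤1+n; 1+n≢n; suc-injective; ≡ᵇ⇒≡; ≡⇒≡ᵇ)
open import Data.Product using (Σ; _×_; _,_)
open import Relation.Binary.PropositionalEquality using (_≢_; ≢-sym; refl; sym; trans; cong; cong₂; subst)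
open import Relation.Nullary using (contradiction)

module _ {A : Set} {R : A → A → Set} where

  ∷-head⁺ : ∀ {x y ys} → R x y → head ys ≡ just y → Linked R ys → Linked R (x ∷ ys)
  ∷-head⁺ {ys = _ ∷ _} r refl rys = r ∷ rys

  ++-last⁺ : ∀ {x xs ys} → Linked R xs → last xs ≡ just x → Linked R (x ∷ ys) → Linked R (xs ++ ys)
  ++-last⁺ {ys = ys} rxs eq rys =
    Linkedₚ.++⁺ rxs (subst (λ mx → Connected R mx (head ys)) (sym eq) (head′ rys)) (tail rys)

last-∷ʳ : ∀ {A : Set} (xs : List A) x → last (xs ∷ʳ x) ≡ just x
last-∷ʳ []           x = refl
last-∷ʳ (_ ∷ [])     x = refl
last-∷ʳ (_ ∷ y ∷ xs) x = last-∷ʳ (y ∷ xs) x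

length-∷ʳ : ∀ {A : Set} (xs : List A) x → length (xs ∷ʳ x) ≡ suc (length xs)
length-∷ʳ xs x = trans (length-++ xs) (+-comm (length xs) 1)

rightmost-∷ʳ : ∀ w d → rightmost (w ∷ʳ d) ≡ d
rightmost-∷ʳ w d rewrite last-∷ʳ w d = refl

hamming-∷-same : ∀ d xs ys → hamming (d ∷ xs) (d ∷ ys) ≡ hamming xs ys
hamming-∷-same d xs ys with d ≡ᵇ d | ≡⇒≡ᵇ d d refl
... | true | _ = refl

hamming-∷-≢ : ∀ {a b} xs ys → a ≢ b → hamming (a ∷ xs) (b ∷ ys) ≡ suc (hamming xs ys)
hamming-∷-≢ {a} {b} xs ys a≢b with a ≡ᵇ b | ≡ᵇ⇒≡ a b
... | false | _   = refl
... | true  | a≡b = contradiction (a≡b _) a≢b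

hamming-∷ʳ : ∀ x y d → length x ≡ length y → hamming (x ∷ʳ d) (y ∷ʳ d) ≡ hamming x y
hamming-∷ʳ []      []      d _  = hamming-∷-same d [] []
hamming-∷ʳ (a ∷ x) (b ∷ y) d eq =
  cong ((if a ≡ᵇ b then 0 else 1) +_) (hamming-∷ʳ x y d (suc-injective eq))

hamming-∷ʳ-≢ : ∀ x {a b} → a ≢ b → hamming (x ∷ʳ a) (x ∷ʳ b) ≡ 1
hamming-∷ʳ-≢ []      a≢b = hamming-∷-≢ [] [] a≢b
hamming-∷ʳ-≢ (c ∷ x) a≢b = trans (hamming-∷-same c (x ∷ʳ _) (x ∷ʳ _)) (hamming-∷ʳ-≢ x a≢b)

Adjacent : Word → Word → Set
Adjacent x y = hamming x y ≡ 1

∘ʷ-adjacent : ∀ x {P} → Linked _≢_ P → Linked Adjacent (x ∘ʷ P)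
∘ʷ-adjacent x distinct = Linkedₚ.map⁺ (Linked.map (hamming-∷ʳ-≢ x) distinct)

last-∘ʷ : ∀ x P {d} → last P ≡ just d → last (x ∘ʷ P) ≡ just (x ∷ʳ d)
last-∘ʷ x P eq = trans (last-map (x ∷ʳ_) P) (cong (Maybe.map (x ∷ʳ_)) eq)

head-∘ʷ-++ : ∀ x P {d} ys → head P ≡ just d → head (x ∘ʷ P ++ ys) ≡ just (x ∷ʳ d)
head-∘ʷ-++ x (_ ∷ _) ys refl = refl

lastDigit-∘ʷ : ∀ x P {d} → last P ≡ just d → lastDigit (x ∘ʷ P) ≡ d
lastDigit-∘ʷ x (d ∷ [])    refl = rightmost-∷ʳ x d
lastDigit-∘ʷ x (_ ∷ e ∷ P) eq   = lastDigit-∘ʷ x (e ∷ P) eq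

lastDigit-∘ʷ-≥2 : ∀ x {P} → All (2 ≤_) P → 2 ≤ lastDigit (x ∘ʷ P)
lastDigit-∘ʷ-≥2 x []               = ≤-refl
lastDigit-∘ʷ-≥2 x (d≥2 ∷ [])       = subst (2 ≤_) (sym (rightmost-∷ʳ x _)) d≥2
lastDigit-∘ʷ-≥2 x (_ ∷ ds@(_ ∷ _)) = lastDigit-∘ʷ-≥2 x ds

∘ʷ-All : ∀ {Q : Word → Set} x {P} → (∀ {d} → 2 ≤ d → Q (x ∷ʳ d)) → All (2 ≤_) P → All Q (x ∘ʷ P)
∘ʷ-All x ext ds = Allₚ.map⁺ (All.map ext ds)

∘ʷ-blocks-adjacent : ∀ x P {d ls} → Linked _≢_ P → last P ≡ just d →
                     Linked Adjacent ((x ∷ʳ d) ∷ blocks d ls) →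
                     Linked Adjacent (x ∘ʷ P ++ blocks (lastDigit (x ∘ʷ P)) ls)
∘ʷ-blocks-adjacent x P {ls = ls} distinct eq rest =
  ++-last⁺ (∘ʷ-adjacent x distinct) (last-∘ʷ x P eq)
           (subst (λ q → Linked Adjacent ((x ∷ʳ _) ∷ blocks q ls)) (sym (lastDigit-∘ʷ x P eq)) rest)

range-distinct : ∀ a l → Linked _≢_ (range a l)
range-distinct a zero          = []
range-distinct a (suc zero)    = [-]
range-distinct a (suc (suc l)) = ≢-sym 1+n≢n ∷ range-distinct (suc a) (suc l)

range-lowerBound : ∀ a l → All (a ≤_) (range a l)
range-lowerBound a zero    = []
range-lowerBound a (suc l) = ≤-refl ∷ All.map (≤-trans (n≤1+n a)) (range-lowerBound (suc a) l)

last-range : ∀ a l → last (range a (suc l)) ≡ just (a + l)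
last-range a zero    = cong just (sym (+-identityʳ a))
last-range a (suc l) = trans (last-range (suc a) l) (cong just (sym (+-suc a l)))

range≗applyUpTo : ∀ a l {f : ℕ → ℕ} → (∀ i → f i ≡ a + i) → range a l ≡ applyUpTo f l
range≗applyUpTo a zero    _  = refl
range≗applyUpTo a (suc l) f≗ =
  cong₂ _∷_ (sym (trans (f≗ 0) (+-identityʳ a)))
            (range≗applyUpTo (suc a) l (λ i → trans (f≗ (suc i)) (+-suc a i)))

reverse-range : ∀ a l → reverse (range a l) ≡ applyDownFrom (a +_) l
reverse-range a l = trans (cong reverse (range≗applyUpTo a l λ _ → refl)) (reverse-applyUpTo (a +_) l)

last-applyDownFrom : ∀ (f : ℕ → ℕ) n → last (applyDownFrom f (suc n)) ≡ just (f 0)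
last-applyDownFrom f zero    = refl
last-applyDownFrom f (suc n) = last-applyDownFrom f n

data TwoOrThree : ℕ → Set where
  two   : TwoOrThree 2
  three : TwoOrThree 3

s-≥2 : ∀ k {i} → 2 ≤ i → All (2 ≤_) (s k i)
s-≥2 k {1} (s≤s ())
s-≥2 k {2} _ =
  ≤-refl ∷ subst (All (2 ≤_)) (sym (reverse-range 3 l))
                 (Allₚ.applyDownFrom⁺₂ (3 +_) l λ _ → s≤s (s≤s z≤n))
  where l = suc (suc k) ∸ 3
s-≥2 k {suc (suc (suc j))} _ =
  Allₚ.++⁺ (All.map (≤-trans (s≤s (s≤s z≤n))) (range-lowerBound (3 + j) (suc (suc k) ∸ (3 + j))))
           (range-lowerBound 2 (suc j))

s-head : ∀ {k i} → 2 ≤ k → TwoOrThree i → head (s k i) ≡ just i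
s-head _             two   = refl
s-head (s≤s (s≤s _)) three = refl

s-last : ∀ {k i} → 2 ≤ k → TwoOrThree i → Σ ℕ λ j → TwoOrThree j × last (s k i) ≡ just j
s-last {suc (suc j)} (s≤s (s≤s _)) two =
  3 , three , subst (λ xs → last (2 ∷ xs) ≡ just 3) (sym (reverse-range 3 (suc j)))
                    (last-applyDownFrom (3 +_) j)
s-last {suc (suc j)} (s≤s (s≤s _)) three = 2 , two , last-∷ʳ (range 3 (suc j)) 2

s-distinct : ∀ {k i} → 2 ≤ k → TwoOrThree i → Linked _≢_ (s k i)
s-distinct {suc (suc j)} (s≤s (s≤s _)) two =
  subst (λ xs → Linked _≢_ (2 ∷ xs)) (sym (reverse-range 3 (suc j)))
        ((λ ()) ∷ Linkedₚ.applyDownFrom⁺₂ (3 +_) (suc j) λ _ → 1+n≢n)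
s-distinct {suc (suc j)} (s≤s (s≤s _)) three =
  ++-last⁺ (range-distinct 3 (suc j)) (last-range 3 j) ((λ ()) ∷ [-])

blocks-All : ∀ {P Q : Word → Set} {i ls} → (∀ w {d} → P w → 2 ≤ d → Q (w ∷ʳ d)) →
             2 ≤ i → All P ls → All Q (blocks i ls)
blocks-All ext i≥2 []                      = []
blocks-All {ls = l ∷ _} ext i≥2 (pl ∷ pls) =
  Allₚ.++⁺ (∘ʷ-All l (ext l pl) (s-≥2 _ i≥2))
           (blocks-All ext (lastDigit-∘ʷ-≥2 l (s-≥2 _ i≥2)) pls)

step-All : ∀ {P Q : Word → Set} {L} → (∀ w {d} → P w → 2 ≤ d → Q (w ∷ʳ d)) → All P L → All Q (step L)
step-All ext []                      = []
step-All {L = l ∷ _} ext (pl ∷ pls) =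
  Allₚ.++⁺ (∘ʷ-All l (ext l pl) (s-≥2 2 ≤-refl))
           (blocks-All ext (lastDigit-∘ʷ-≥2 l (s-≥2 2 ≤-refl)) pls)

Admissible : ℕ → Word → Set
Admissible m w = length w ≡ m × 2 ≤ rightmost w

∷ʳ-admissible : ∀ {m} w {d} → Admissible m w → 2 ≤ d → Admissible (suc m) (w ∷ʳ d)
∷ʳ-admissible w {d} (len , _) d≥2 =
  trans (length-∷ʳ w d) (cong suc len) , subst (2 ≤_) (sym (rightmost-∷ʳ w d)) d≥2

𝓛-admissible : ∀ n → All (Admissible (suc n)) (𝓛 (suc n))
𝓛-admissible zero    = (refl , ≤-refl) ∷ []
𝓛-admissible (suc n) = step-All ∷ʳ-admissible (𝓛-admissible n)

blocks-adjacent : ∀ {m i p ls} → TwoOrThree i → length p ≡ m → All (Admissible m) ls →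
                  Linked Adjacent (p ∷ ls) → Linked Adjacent ((p ∷ʳ i) ∷ blocks i ls)
blocks-adjacent _ _ [] _ = [-]
blocks-adjacent {i = i} {p} {l ∷ ls} t len ((len′ , k≥2) ∷ adm) (pl ∷ linked)
  with s-last k≥2 t
... | _ , t′ , last≡j =
  ∷-head⁺ (trans (hamming-∷ʳ p l i (trans len (sym len′))) pl)
          (head-∘ʷ-++ l (s _ i) _ (s-head k≥2 t))
          (∘ʷ-blocks-adjacent l (s _ i) {ls = ls} (s-distinct k≥2 t) last≡j
                              (blocks-adjacent t′ len′ adm linked))

step-adjacent : ∀ {m L} → All (Admissible m) L → Linked Adjacent L → Linked Adjacent (step L)
step-adjacent [] _ = []
step-adjacent {L = l ∷ ls} ((len , _) ∷ adm) linked =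
  ∘ʷ-blocks-adjacent l (2 ∷ 3 ∷ []) {ls = ls} ((λ ()) ∷ [-]) refl
                     (blocks-adjacent three len adm linked)

theorem1 : (n : ℕ) → n ≥ 1 → Linked (λ x y → hamming x y ≡ 1) (𝓛 n)
theorem1 (suc zero)    _ = [-]
theorem1 (suc (suc n)) _ = step-adjacent (𝓛-admissible n) (theorem1 (suc n) (s≤s z≤n))
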